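{- $(P^*,\tau)$ is primitive: there exists $k\in\mathbb{N}$ such that for all $t,t'\in P^*$, $t'$ appears in $\tau^k(t)$.
   Context: Let $p$ be an odd prime and $\mathbb{F}_p$ the field with $p$ elements. A (one-dimensional) tile $\square(x,y)$ is a unit segment whose left and right endpoints are decorated with $x,y\in\mathbb{F}_p$. $P$ is the set of all such tiles and $P^*=P\setminus\{\square(0,0)\}$. The substitution $\tau$ maps $\square(x,y)$ to the sequence of two tiles $\square(x,x+y)\,\square(x+y,y)$; it acts on finite sequences of tiles by concatenating images. A tile $t'$ appears in $\tau^k(t)$ if it is one of the $2^k$ tiles of the sequence $\tau^k(t)$. -}

module Defs where

open import Data.Nat using (ℕ; zero; suc; NonZero)
open import Data.Nat.DivMod using (_mod_)
open import Data.Fin using (Fin; toℕ)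
open import Data.Product using (_×_; _,_)
open import Data.List using (List; []; _∷_; _++_; concatMap)
open import Data.List.Membership.Propositional using (_∈_)
open import Relation.Binary.PropositionalEquality using (_≡_)
open import Relation.Nullary using (¬_)
import Data.Nat as ℕ

𝔽 : ℕ → Set
𝔽 p = Fin p

add : (p : ℕ) .{{_ : NonZero p}} → 𝔽 p → 𝔽 p → 𝔽 p
add p x y = (toℕ x ℕ.+ toℕ y) mod p

zeroF : (p : ℕ) .{{_ : NonZero p}} → 𝔽 p
zeroF p = 0 mod p

-- a tile □(x,y): left decoration x, right decoration y
Tile : ℕ → Set
Tile p = 𝔽 p × 𝔽 p

InPStar : (p : ℕ) .{{_ : NonZero p}} → Tile p → Set
InPStar p t = ¬ (t ≡ (zeroF p , zeroF p))

τ₁ : (p : ℕ) .{{_ : NonZero p}} → Tile p → List (Tile p)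
τ₁ p (x , y) = (x , add p x y) ∷ (add p x y , y) ∷ []

τ : (p : ℕ) .{{_ : NonZero p}} → List (Tile p) → List (Tile p)
τ p = concatMap (τ₁ p)

τ^ : (p : ℕ) .{{_ : NonZero p}} → ℕ → List (Tile p) → List (Tile p)
τ^ p zero s = s
τ^ p (suc k) s = τ p (τ^ p k s)

AppearsIn : (p : ℕ) .{{_ : NonZero p}} → ℕ → Tile p → Tile p → Set
AppearsIn p k t t' = t' ∈ τ^ p k (t ∷ [])

-- A tile □(x, y) with x ≠ 0 reaches every □(x, z) by repeatedly taking the left
-- child, since y + kx runs through all of 𝔽ₚ; symmetrically for the right child
-- when y ≠ 0. So every tile of P* reaches the hub □(0, 1) in at most three such
-- moves, and the hub reaches every tile of P* in at most three moves. The hub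
-- reproduces itself under τ, so waiting there equalises all path lengths.
module Submission where

open import Defs
open import Data.Nat using (ℕ; NonZero; _≤_)
open import Data.Nat.Primality using (Prime)
open import Data.Product using (∃)

open import Data.Nat.Base using (zero; suc; _+_; _*_; _∸_; _<_; _%_; ≢-nonZero; nonTrivial⇒n>1)
open import Data.Nat.Properties using (*-assoc; +-assoc; +-comm; ≤-trans; <⇒≤; +-mono-≤; m≤n+m; m∸n+n≡m; m+[n∸m]≡n)
open import Data.Nat.DivMod using (_mod_; %-congˡ; %-distribˡ-+; %-distribˡ-*; m%n%n≡m%n; [m+kn]%n≡m%n; m%n<n; m<n⇒m%n≡m; m*n%n≡0)
open import Data.Nat.GeneralisedArithmetic using (fold)
open import Data.Nat.Coprimality using (Coprime; coprime-Bézout; prime⇒coprime) renaming (sym to coprime-sym)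
open import Data.Nat.GCD using (module Bézout)
open import Data.Nat.Tactic.RingSolver using (solve-∀)
open import Data.Fin.Base using (toℕ; fromℕ<)
open import Data.Fin.Properties using (toℕ-injective; toℕ-fromℕ<; toℕ<n; _≟_)
open import Data.Product using (_×_; _,_)
open import Data.List.Base using (_∷_; [])
open import Data.List.Membership.Propositional using (_∈_)
open import Data.List.Relation.Unary.Any using (here; there)
open import Data.List.Relation.Binary.Subset.Propositional using (_⊆_)
open import Data.List.Relation.Binary.Subset.Propositional.Properties using (concatMap⁺)
open import Relation.Binary.PropositionalEquality
open import Relation.Nullary using (yes; no)
open ≡-Reasoning

%-cong-*-+ : ∀ {n} .{{_ : NonZero n}} a a′ b c → a % n ≡ a′ % n →
             (a * b + c) % n ≡ (a′ * b + c) % n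
%-cong-*-+ {n} a a′ b c a≡a′ = begin
  (a * b + c) % n                      ≡⟨ %-distribˡ-+ (a * b) c n ⟩
  ((a * b) % n + c % n) % n            ≡⟨ cong (λ x → (x + c % n) % n) (%-distribˡ-* a b n) ⟩
  ((a % n * (b % n)) % n + c % n) % n  ≡⟨ cong (λ x → ((x * (b % n)) % n + c % n) % n) a≡a′ ⟩
  ((a′ % n * (b % n)) % n + c % n) % n ≡⟨ cong (λ x → (x + c % n) % n) (%-distribˡ-* a′ b n) ⟨
  ((a′ * b) % n + c % n) % n           ≡⟨ %-distribˡ-+ (a′ * b) c n ⟨
  (a′ * b + c) % n                     ∎

coprime⇒%-inverse : ∀ {a n} .{{_ : NonZero n}} → Coprime a n → ∃ λ u → (u * a) % n ≡ 1 % n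
coprime⇒%-inverse {a} {n@(suc m)} a⊥n with coprime-Bézout a⊥n
... | Bézout.+- x y 1+yn≡xa = x , (begin
  (x * a) % n      ≡⟨ %-congˡ (sym 1+yn≡xa) ⟩
  (1 + y * n) % n  ≡⟨ [m+kn]%n≡m%n 1 y n ⟩
  1 % n            ∎)
-- Here x·a ≡ −1, so (n − 1)·x inverts a.
... | Bézout.-+ x y 1+xa≡yn = m * x , (begin
  (m * x * a) % n            ≡⟨ [m+kn]%n≡m%n (m * x * a) 1 n ⟨
  (m * x * a + 1 * n) % n    ≡⟨ %-congˡ (rearrange m x a) ⟩
  (1 + m * (1 + x * a)) % n  ≡⟨ %-congˡ (cong (λ k → 1 + m * k) 1+xa≡yn) ⟩
  (1 + m * (y * n)) % n      ≡⟨ %-congˡ (cong (1 +_) (*-assoc m y n)) ⟨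
  (1 + m * y * n) % n        ≡⟨ [m+kn]%n≡m%n 1 (m * y) n ⟩
  1 % n                      ∎)
  where
  rearrange : ∀ m x a → m * x * a + 1 * suc m ≡ 1 + m * (1 + x * a)
  rearrange = solve-∀

linear-congruence : ∀ {a n} .{{_ : NonZero n}} → Coprime a n →
                    ∀ b c → ∃ λ k → k < n × (k * a + b) % n ≡ c % n
linear-congruence {a} {n@(suc m)} a⊥n b c with coprime⇒%-inverse a⊥n
... | u , ua≡1 = (u * d) % n , m%n<n (u * d) n , (begin
  ((u * d) % n * a + b) % n  ≡⟨ %-cong-*-+ ((u * d) % n) (u * d) a b (m%n%n≡m%n (u * d) n) ⟩
  (u * d * a + b) % n        ≡⟨ %-congˡ (cong (_+ b) (commute u d a)) ⟩
  (u * a * d + b) % n        ≡⟨ %-cong-*-+ (u * a) 1 d b ua≡1 ⟩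
  (1 * d + b) % n            ≡⟨ %-congˡ (rearrange m b c) ⟩
  (c + b * n) % n            ≡⟨ [m+kn]%n≡m%n c b n ⟩
  c % n                      ∎)
  where
  -- d ≡ c − b
  d : ℕ
  d = c + m * b

  commute : ∀ u d a → u * d * a ≡ u * a * d
  commute = solve-∀

  rearrange : ∀ m b c → 1 * (c + m * b) + b ≡ c + b * suc m
  rearrange = solve-∀

module _ (p : ℕ) .{{_ : NonZero p}} where

  private variable
    x y u : 𝔽 p
    s t v : Tile p
    k l B C : ℕ

  toℕ-zeroF : toℕ (zeroF p) ≡ 0
  toℕ-zeroF = trans (toℕ-fromℕ< (m%n<n 0 p)) (m*n%n≡0 0 p)

  toℕ≢0 : x ≢ zeroF p → toℕ x ≢ 0
  toℕ≢0 x≢0 toℕx≡0 = x≢0 (toℕ-injective (trans toℕx≡0 (sym toℕ-zeroF)))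

  toℕ-add : ∀ x y → toℕ (add p x y) ≡ (toℕ x + toℕ y) % p
  toℕ-add x y = toℕ-fromℕ< (m%n<n (toℕ x + toℕ y) p)

  add-comm : ∀ x y → add p x y ≡ add p y x
  add-comm x y = cong (λ m → m mod p) (+-comm (toℕ x) (toℕ y))

  add-identityˡ : ∀ y → add p (zeroF p) y ≡ y
  add-identityˡ y = toℕ-injective (begin
    toℕ (add p (zeroF p) y)        ≡⟨ toℕ-add (zeroF p) y ⟩
    (toℕ (zeroF p) + toℕ y) % p    ≡⟨ cong (λ m → (m + toℕ y) % p) toℕ-zeroF ⟩
    toℕ y % p                      ≡⟨ m<n⇒m%n≡m (toℕ<n y) ⟩
    toℕ y                          ∎)

  toℕ-fold-add : ∀ x y k → toℕ (fold y (add p x) k) ≡ (k * toℕ x + toℕ y) % p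
  toℕ-fold-add x y zero    = sym (m<n⇒m%n≡m (toℕ<n y))
  toℕ-fold-add x y (suc k) = begin
    toℕ (add p x (fold y (add p x) k))       ≡⟨ toℕ-add x _ ⟩
    (toℕ x + toℕ (fold y (add p x) k)) % p   ≡⟨ cong (λ m → (toℕ x + m) % p) (toℕ-fold-add x y k) ⟩
    (toℕ x + w % p) % p                      ≡⟨ %-distribˡ-+ (toℕ x) (w % p) p ⟩
    (toℕ x % p + w % p % p) % p              ≡⟨ cong (λ m → (toℕ x % p + m) % p) (m%n%n≡m%n w p) ⟩
    (toℕ x % p + w % p) % p                  ≡⟨ %-distribˡ-+ (toℕ x) w p ⟨
    (toℕ x + w) % p                          ≡⟨ %-congˡ (+-assoc (toℕ x) (k * toℕ x) (toℕ y)) ⟨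
    (suc k * toℕ x + toℕ y) % p              ∎
    where
    w : ℕ
    w = k * toℕ x + toℕ y

  fold-add-surjective : Prime p → x ≢ zeroF p → ∀ y z → ∃ λ k → k < p × fold y (add p x) k ≡ z
  fold-add-surjective {x} p-prime x≢0 y z =
    let k , k<p , k·x+y≡z = linear-congruence x⊥p (toℕ y) (toℕ z) in
    k , k<p , toℕ-injective (begin
      toℕ (fold y (add p x) k)  ≡⟨ toℕ-fold-add x y k ⟩
      (k * toℕ x + toℕ y) % p   ≡⟨ k·x+y≡z ⟩
      toℕ z % p                 ≡⟨ m<n⇒m%n≡m (toℕ<n z) ⟩
      toℕ z                     ∎)
    where
    x⊥p : Coprime (toℕ x) p
    x⊥p = coprime-sym (prime⇒coprime p-prime {{≢-nonZero (toℕ≢0 x≢0)}} (toℕ<n x))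

  τ^-mono : ∀ k {xs ys} → xs ⊆ ys → τ^ p k xs ⊆ τ^ p k ys
  τ^-mono zero    xs⊆ys = xs⊆ys
  τ^-mono (suc k) xs⊆ys = concatMap⁺ (τ₁ p) (τ^-mono k xs⊆ys)

  τ^-+ : ∀ k l xs → τ^ p (k + l) xs ≡ τ^ p k (τ^ p l xs)
  τ^-+ zero    l xs = refl
  τ^-+ (suc k) l xs = cong (τ p) (τ^-+ k l xs)

  appearsIn-trans : ∀ k l {s t v} → AppearsIn p k s t → AppearsIn p l t v → AppearsIn p (l + k) s v
  appearsIn-trans k l {s} {t} {v} s→t t→v =
    subst (v ∈_) (sym (τ^-+ l k (s ∷ []))) (τ^-mono l (λ { (here refl) → s→t }) t→v)

  appearsIn-foldˡ : ∀ k → AppearsIn p k (x , y) (x , fold y (add p x) k)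
  appearsIn-foldˡ zero    = here refl
  appearsIn-foldˡ (suc k) = appearsIn-trans k 1 (appearsIn-foldˡ k) (here refl)

  appearsIn-foldʳ : ∀ k → AppearsIn p k (x , y) (fold x (add p y) k , y)
  appearsIn-foldʳ {y = y} zero    = here refl
  appearsIn-foldʳ {y = y} (suc k) =
    appearsIn-trans k 1 (appearsIn-foldʳ k) (there (here (cong (_, y) (add-comm y _))))

  Stable : Tile p → Set
  Stable t = AppearsIn p 1 t t

  stable-zeroF : ∀ y → Stable (zeroF p , y)
  stable-zeroF y = here (cong (zeroF p ,_) (sym (add-identityˡ y)))

  stable⇒appearsIn-self : Stable t → ∀ k → AppearsIn p k t t
  stable⇒appearsIn-self t-stable zero    = here refl
  stable⇒appearsIn-self t-stable (suc k) =
    appearsIn-trans k 1 (stable⇒appearsIn-self t-stable k) t-stable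

  AppearsWithin : ℕ → Tile p → Tile p → Set
  AppearsWithin B s t = ∃ λ k → k ≤ B × AppearsIn p k s t

  appearsWithin-trans : AppearsWithin B s t → AppearsWithin C t v → AppearsWithin (C + B) s v
  appearsWithin-trans (k , k≤B , s→t) (l , l≤C , t→v) =
    l + k , +-mono-≤ l≤C k≤B , appearsIn-trans k l s→t t→v

  appearsWithin-weaken : B ≤ C → AppearsWithin B s t → AppearsWithin C s t
  appearsWithin-weaken B≤C (k , k≤B , s→t) = k , ≤-trans k≤B B≤C , s→t

  appearsWithin-stable-target : Stable t → AppearsWithin B s t → AppearsIn p B s t
  appearsWithin-stable-target {t} {B} {s} t-stable (k , k≤B , s→t) =
    subst (λ m → AppearsIn p m s t) (m∸n+n≡m k≤B)
      (appearsIn-trans k (B ∸ k) s→t (stable⇒appearsIn-self t-stable (B ∸ k)))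

  appearsWithin-stable-source : Stable s → AppearsWithin B s t → AppearsIn p B s t
  appearsWithin-stable-source {s} {B} {t} s-stable (k , k≤B , s→t) =
    subst (λ m → AppearsIn p m s t) (m+[n∸m]≡n k≤B)
      (appearsIn-trans (B ∸ k) k (stable⇒appearsIn-self s-stable (B ∸ k)) s→t)

  moveˡ : Prime p → x ≢ zeroF p → ∀ y z → AppearsWithin p (x , y) (x , z)
  moveˡ {x} p-prime x≢0 y z =
    let k , k<p , orbit-hits-z = fold-add-surjective p-prime x≢0 y z in
    k , <⇒≤ k<p , subst (λ w → AppearsIn p k (x , y) (x , w)) orbit-hits-z (appearsIn-foldˡ k)

  moveʳ : Prime p → y ≢ zeroF p → ∀ x z → AppearsWithin p (x , y) (z , y)
  moveʳ {y} p-prime y≢0 x z =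
    let k , k<p , orbit-hits-z = fold-add-surjective p-prime y≢0 x z in
    k , <⇒≤ k<p , subst (λ w → AppearsIn p k (x , y) (w , y)) orbit-hits-z (appearsIn-foldʳ k)

  appearsWithin-toHub : Prime p → u ≢ zeroF p → ∀ {t} → InPStar p t →
                          AppearsWithin (p + (p + p)) t (zeroF p , u)
  appearsWithin-toHub {u} p-prime u≢0 {x , y} xy≢0 with x ≟ zeroF p
  ... | no x≢0 = appearsWithin-weaken (m≤n+m (p + p) p)
    (appearsWithin-trans (moveˡ p-prime x≢0 y u) (moveʳ p-prime u≢0 x (zeroF p)))
  ... | yes refl = appearsWithin-trans
    (appearsWithin-trans (moveʳ p-prime y≢0 (zeroF p) u) (moveˡ p-prime u≢0 y u))
    (moveʳ p-prime u≢0 u (zeroF p))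
    where
    y≢0 : y ≢ zeroF p
    y≢0 refl = xy≢0 refl

  appearsWithin-fromHub : Prime p → u ≢ zeroF p → ∀ {t} → InPStar p t →
                            AppearsWithin (p + (p + p)) (zeroF p , u) t
  appearsWithin-fromHub {u} p-prime u≢0 {x , y} xy≢0 with y ≟ zeroF p
  ... | no y≢0 = appearsWithin-trans
    (appearsWithin-trans (moveʳ p-prime u≢0 (zeroF p) u) (moveˡ p-prime u≢0 u y))
    (moveʳ p-prime y≢0 u x)
  ... | yes refl = appearsWithin-weaken (m≤n+m (p + p) p)
    (appearsWithin-trans (moveʳ p-prime u≢0 (zeroF p) x) (moveˡ p-prime x≢0 u (zeroF p)))
    where
    x≢0 : x ≢ zeroF p
    x≢0 refl = xy≢0 refl

mainTheorem16 : (p : ℕ) .{{_ : NonZero p}} → Prime p → 3 ≤ p →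
    ∃ λ (k : ℕ) → ∀ (t t' : Tile p) → InPStar p t → InPStar p t' →
      AppearsIn p k t t'
mainTheorem16 p p-prime _ = H + H , λ t t′ t∈P* t′∈P* →
  appearsIn-trans p H H
    (appearsWithin-stable-target p (stable-zeroF p one) (appearsWithin-toHub p p-prime one≢0 t∈P*))
    (appearsWithin-stable-source p (stable-zeroF p one) (appearsWithin-fromHub p p-prime one≢0 t′∈P*))
  where
  open Prime p-prime using (nontrivial)

  H : ℕ
  H = p + (p + p)

  one : 𝔽 p
  one = fromℕ< (nonTrivial⇒n>1 p)

  one≢0 : one ≢ zeroF p
  one≢0 one≡0 with trans (sym (toℕ-fromℕ< (nonTrivial⇒n>1 p))) (trans (cong toℕ one≡0) (toℕ-zeroF p))
  ... | ()
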